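{- If $\mathcal M$ is a faithful $4$-maniplex, then every $i$-face of $\mathcal M$ with $i\in\{1,2\}$ is a bipartite graph.
   Context: An $n$-maniplex is a finite simple connected $n$-valent graph with a proper edge-colouring by $\{0,\dots,n-1\}$ such that, whenever $|i-j|>1$, every connected subgraph induced by edges of colours $i$ and $j$ is a $4$-cycle. Vertices are flags. An $i$-face is a connected component of the subgraph obtained by deleting all edges of colour $i$ (regarded as a graph). The maniplex is faithful if for every flag $\Phi$ the intersection of all faces of ranks $0,\dots,n-1$ containing $\Phi$ is $\{\Phi\}$. -}

module Defs where

open import Data.Nat using (ℕ; _<_; ∣_-_∣)
open import Data.Fin using (Fin; toℕ)
open import Data.Bool using (Bool)
open import Data.Product using (Σ; ∃; _×_)
open import Relation.Binary.PropositionalEquality using (_≡_; _≢_)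

-- Since every vertex has exactly one edge of each colour j, the colour-j edges
-- form a perfect matching, encoded as the involution r j (Φ ↦ its j-neighbour).
record Maniplex (n : ℕ) : Set where
  field
    N      : ℕ
    r      : Fin n → Fin N → Fin N
    invol  : ∀ j Φ → r j (r j Φ) ≡ Φ
    noLoop : ∀ j Φ → r j Φ ≢ Φ
    -- no multiple edges (simple graph; also makes the colouring proper)
    simple : ∀ i j Φ → i ≢ j → r i Φ ≢ r j Φ
    -- for |i - j| > 1, each {i,j}-component is a 4-cycle
    -- (Φ, r i Φ, r j r i Φ = r i r j Φ, r j Φ)
    fourCycle : ∀ i j Φ → 1 < ∣ toℕ i - toℕ j ∣ → r i (r j Φ) ≡ r j (r i Φ)

module _ {n : ℕ} (M : Maniplex n) where
  open Maniplex M

  data ReachAvoid (k : Fin n) : Fin N → Fin N → Set where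
    here : ∀ {Φ} → ReachAvoid k Φ Φ
    step : ∀ {Φ Ψ} j → j ≢ k → ReachAvoid k Φ Ψ → ReachAvoid k Φ (r j Ψ)

  data Reach : Fin N → Fin N → Set where
    here : ∀ {Φ} → Reach Φ Φ
    step : ∀ {Φ Ψ} j → Reach Φ Ψ → Reach Φ (r j Ψ)

  Connected : Set
  Connected = ∀ Φ Ψ → Reach Φ Ψ

  InFace : Fin n → Fin N → Fin N → Set
  InFace k Φ Ψ = ReachAvoid k Φ Ψ

  Faithful : Set
  Faithful = ∀ Φ Ψ → (∀ k → InFace k Φ Ψ) → Ψ ≡ Φ

  FaceBipartite : Fin n → Fin N → Set
  FaceBipartite k Φ =
    Σ (Fin N → Bool) λ c →
      ∀ Ψ → InFace k Φ Ψ → ∀ j → j ≢ k → c (r j Ψ) ≢ c Ψ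

-- For i ∈ {1, 2} the colours other than i are two adjacent colours x, y and a
-- third colour z commuting with both (x, y, z = 2, 3, 0 for i = 1 and 0, 1, 3
-- for i = 2). The {x,y}-component C of a flag Φ is an alternating polygon,
-- hence of even length, and since z commutes with x and y the i-face of Φ is
-- C ∪ zC. Faithfulness makes C and zC disjoint: if Ψ and zΨ both lay in C,
-- then zΨ would lie in every face of Ψ. So the face is a prism over an even
-- polygon; colour C by parity and zC by the opposite parity.
module Submission where

open import Defs
open import Data.Fin using (Fin; toℕ; fromℕ<; #_)
open import Data.Fin.Properties using (pigeonhole; any?; toℕ-fromℕ<; _≟_)
open import Data.Nat using (ℕ; zero; suc; _+_; _*_; z<s; s<s)
open import Data.Nat.DivMod using (_%_; _/_; m≡m%n+[m/n]*n; m%n<n)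
open import Data.Nat.GeneralisedArithmetic using (fold; fold-+)
open import Data.Nat.Properties using (n<1+n; +-suc; m≤n⇒∃[o]m+o≡n)
open import Data.Product using (∃; _,_; proj₁; proj₂)
open import Data.Sum using (_⊎_; inj₁; inj₂; swap; map)
open import Level using (Level)
open import Relation.Nullary using (¬_; Dec; yes; no; does; contradiction)
open import Relation.Nullary.Decidable using (map′; _⊎-dec_)
open import Relation.Binary.PropositionalEquality

private
  variable
    a p q : Level
    A : Set a

Orbit : (A → A) → A → A → Set _
Orbit h Φ Ψ = ∃ λ k → fold Φ h k ≡ Ψ

orbit-step : ∀ {h : A → A} {Φ Ψ} → Orbit h Φ Ψ → Orbit h Φ (h Ψ)
orbit-step (k , e) = suc k , cong _ e

fold-suc : ∀ (h : A → A) x n → fold x h (suc n) ≡ fold (h x) h n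
fold-suc h x zero    = refl
fold-suc h x (suc n) = cong h (fold-suc h x n)

does-≢ : {P : Set p} {Q : Set q} (P? : Dec P) (Q? : Dec Q) → P → ¬ Q → does Q? ≢ does P?
does-≢ (yes _) (no _)  _  _  ()
does-≢ (yes _) (yes q) _  ¬q _ = ¬q q
does-≢ (no ¬p) _       p  _  _ = ¬p p

module Dihedral (σ τ : A → A)
  (σ-invol : ∀ x → σ (σ x) ≡ x) (τ-invol : ∀ x → τ (τ x) ≡ x)
  (σ-noFix : ∀ x → σ x ≢ x) (τ-noFix : ∀ x → τ x ≢ x) where

  rotate rotate⁻¹ : A → A
  rotate x = τ (σ x)
  rotate⁻¹ x = σ (τ x)

  rotate⁻¹∘rotate : ∀ x → rotate⁻¹ (rotate x) ≡ x
  rotate⁻¹∘rotate x = trans (cong σ (τ-invol (σ x))) (σ-invol x)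

  rotate∘rotate⁻¹ : ∀ x → rotate (rotate⁻¹ x) ≡ x
  rotate∘rotate⁻¹ x = trans (cong τ (σ-invol (τ x))) (τ-invol x)

  rotate-shiftˡ : ∀ {x y} → rotate x ≡ σ y → x ≡ σ (rotate y)
  rotate-shiftˡ {x} e = trans (sym (rotate⁻¹∘rotate x)) (cong rotate⁻¹ e)

  rotate-shiftʳ : ∀ {x y} → x ≡ σ (rotate y) → rotate x ≡ σ y
  rotate-shiftʳ {y = y} e = trans (cong rotate e) (rotate∘rotate⁻¹ (σ y))

  -- The alternating polygon has even length: the walk from ρ^k Φ to σ ρ^m Φ
  -- can be shortened from both ends until it is a single σ- or τ-edge.
  rotate^k≢σ∘rotate^m : ∀ Φ k m → fold Φ rotate k ≢ σ (fold Φ rotate m)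
  rotate^k≢σ∘rotate^m Φ 0 0 e = σ-noFix Φ (sym e)
  rotate^k≢σ∘rotate^m Φ 1 0 e = τ-noFix (σ Φ) e
  rotate^k≢σ∘rotate^m Φ 0 1 e = τ-noFix (σ Φ) (sym (trans (cong σ e) (σ-invol _)))
  rotate^k≢σ∘rotate^m Φ (suc (suc k)) 0 e =
    rotate^k≢σ∘rotate^m (rotate Φ) k 0 (trans (sym (fold-suc rotate Φ k)) (rotate-shiftˡ e))
  rotate^k≢σ∘rotate^m Φ 0 (suc (suc m)) e =
    rotate^k≢σ∘rotate^m (rotate Φ) 0 m (trans (rotate-shiftʳ e) (cong σ (fold-suc rotate Φ m)))
  rotate^k≢σ∘rotate^m Φ (suc k) (suc m) e =
    rotate^k≢σ∘rotate^m (rotate Φ) k m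
      (trans (sym (fold-suc rotate Φ k)) (trans e (cong σ (fold-suc rotate Φ m))))

  orbit-σ-disjoint : ∀ {Φ Ψ} → Orbit rotate Φ Ψ → ¬ Orbit rotate Φ (σ Ψ)
  orbit-σ-disjoint {Φ} (k , refl) (m , e) = rotate^k≢σ∘rotate^m Φ m k e

module FiniteOrbit {N : ℕ} (h h⁻¹ : Fin N → Fin N) (h⁻¹∘h : ∀ x → h⁻¹ (h x) ≡ x)
  (Φ : Fin N) where

  fold-injective : ∀ k {x y} → fold x h k ≡ fold y h k → x ≡ y
  fold-injective zero    e = e
  fold-injective (suc k) e =
    fold-injective k (trans (sym (h⁻¹∘h _)) (trans (cong h⁻¹ e) (h⁻¹∘h _)))

  periodic : ∃ λ p → fold Φ h (suc p) ≡ Φ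
  periodic with pigeonhole (n<1+n N) (λ t → fold Φ h (toℕ t))
  ... | s , t , s<t , e with m≤n⇒∃[o]m+o≡n s<t
  ... | d , s+d≡t = d , fold-injective (toℕ s) (begin
    fold (fold Φ h (suc d)) h (toℕ s) ≡⟨ fold-+ Φ h (toℕ s) ⟨
    fold Φ h (toℕ s + suc d)          ≡⟨ cong (fold Φ h) (trans (+-suc (toℕ s) d) s+d≡t) ⟩
    fold Φ h (toℕ t)                    ≡⟨ e ⟨
    fold Φ h (toℕ s)                    ∎)
    where open ≡-Reasoning

  private
    P : ℕ
    P = suc (proj₁ periodic)

  fold-period-multiple : ∀ q → fold Φ h (q * P) ≡ Φ
  fold-period-multiple zero    = refl
  fold-period-multiple (suc q) = begin
    fold Φ h (P + q * P)          ≡⟨ fold-+ Φ h P ⟩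
    fold (fold Φ h (q * P)) h P   ≡⟨ cong (λ x → fold x h P) (fold-period-multiple q) ⟩
    fold Φ h P                    ≡⟨ proj₂ periodic ⟩
    Φ                             ∎
    where open ≡-Reasoning

  fold-mod : ∀ k → fold Φ h (k % P) ≡ fold Φ h k
  fold-mod k = begin
    fold Φ h (k % P)                          ≡⟨ cong (λ x → fold x h (k % P)) (fold-period-multiple (k / P)) ⟨
    fold (fold Φ h (k / P * P)) h (k % P)     ≡⟨ fold-+ Φ h (k % P) ⟨
    fold Φ h (k % P + k / P * P)              ≡⟨ cong (fold Φ h) (m≡m%n+[m/n]*n k P) ⟨
    fold Φ h k                                ∎
    where open ≡-Reasoning

  orbit? : ∀ Ψ → Dec (Orbit h Φ Ψ)
  orbit? Ψ = map′ fromBounded toBounded (any? λ t → fold Φ h (toℕ t) ≟ Ψ)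
    where
    fromBounded : ∃ (λ (t : Fin P) → fold Φ h (toℕ t) ≡ Ψ) → Orbit h Φ Ψ
    fromBounded (t , e) = toℕ t , e
    toBounded : Orbit h Φ Ψ → ∃ λ (t : Fin P) → fold Φ h (toℕ t) ≡ Ψ
    toBounded (k , e) = fromℕ< (m%n<n k P)
      , trans (cong (fold Φ h) (toℕ-fromℕ< (m%n<n k P))) (trans (fold-mod k) e)

  orbit-h⁻¹ : ∀ {Ψ} → Orbit h Φ Ψ → Orbit h Φ (h⁻¹ Ψ)
  orbit-h⁻¹ (suc k , refl) = k , sym (h⁻¹∘h _)
  orbit-h⁻¹ (zero  , refl) =
    proj₁ periodic , sym (trans (cong h⁻¹ (sym (proj₂ periodic))) (h⁻¹∘h _))

module _ {n : ℕ} (M : Maniplex n) where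
  open Maniplex M

  ReachAvoid-trans : ∀ {k Φ Ψ Θ} → ReachAvoid M k Φ Ψ → ReachAvoid M k Ψ Θ → ReachAvoid M k Φ Θ
  ReachAvoid-trans p here           = p
  ReachAvoid-trans p (step j j≢k q) = step j j≢k (ReachAvoid-trans p q)

  ReachAvoid-sym : ∀ {k Φ Ψ} → ReachAvoid M k Φ Ψ → ReachAvoid M k Ψ Φ
  ReachAvoid-sym here = here
  ReachAvoid-sym {k} (step {Ψ = Ψ} j j≢k p) =
    ReachAvoid-trans (subst (ReachAvoid M k (r j Ψ)) (invol j Ψ) (step j j≢k here))
                     (ReachAvoid-sym p)

  faithful⇒adjacent∉face : Faithful M → ∀ k Ψ → ¬ InFace M k Ψ (r k Ψ)
  faithful⇒adjacent∉face faithful k Ψ p = noLoop k Ψ (faithful Ψ (r k Ψ) inAllFaces)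
    where
    inAllFaces : ∀ l → InFace M l Ψ (r k Ψ)
    inAllFaces l with k ≟ l
    ... | yes refl = p
    ... | no k≢l   = step k k≢l here

  module Prism (faithful : Faithful M) (i x y z : Fin n) (x≢z : x ≢ z) (y≢z : y ≢ z)
    (colours : ∀ j → j ≢ i → j ≡ x ⊎ j ≡ y ⊎ j ≡ z)
    (zx-comm : ∀ Ψ → r z (r x Ψ) ≡ r x (r z Ψ))
    (zy-comm : ∀ Ψ → r z (r y Ψ) ≡ r y (r z Ψ))
    (Φ : Fin N) where

    open Dihedral (r x) (r y) (invol x) (invol y) (noLoop x) (noLoop y)
    open FiniteOrbit rotate rotate⁻¹ rotate⁻¹∘rotate Φ

    C₀ : Fin N → Set
    C₀ = Orbit rotate Φ

    -- C₀ is the set of even flags of C, and r x maps it onto the odd ones.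
    Even Odd : Fin N → Set
    Even Ψ = C₀ Ψ ⊎ C₀ (r x (r z Ψ))
    Odd Ψ = C₀ (r x Ψ) ⊎ C₀ (r z Ψ)

    even? : ∀ Ψ → Dec (Even Ψ)
    even? Ψ = orbit? Ψ ⊎-dec orbit? (r x (r z Ψ))

    C₀⊆face : ∀ {Ψ} → C₀ Ψ → InFace M z Φ Ψ
    C₀⊆face (zero  , refl) = here
    C₀⊆face (suc k , refl) = step y y≢z (step x x≢z (C₀⊆face (k , refl)))

    C₀-z-disjoint : ∀ {Ψ} → C₀ Ψ → ¬ C₀ (r z Ψ)
    C₀-z-disjoint {Ψ} c c′ = faithful⇒adjacent∉face faithful z Ψ
      (ReachAvoid-trans (ReachAvoid-sym (C₀⊆face c)) (C₀⊆face c′))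

    even⇒¬odd : ∀ Ψ → Even Ψ → ¬ Odd Ψ
    even⇒¬odd Ψ (inj₁ c) (inj₁ c′) = orbit-σ-disjoint c c′
    even⇒¬odd Ψ (inj₁ c) (inj₂ c′) = C₀-z-disjoint c c′
    even⇒¬odd Ψ (inj₂ c) (inj₁ c′) = C₀-z-disjoint c′ (subst C₀ (sym (zx-comm Ψ)) c)
    even⇒¬odd Ψ (inj₂ c) (inj₂ c′) = orbit-σ-disjoint c′ c

    even⇒odd : ∀ j → j ≢ i → ∀ Ψ → Even Ψ → Odd (r j Ψ)
    even⇒odd j j≢i Ψ e with colours j j≢i | e
    ... | inj₁ refl        | inj₁ c = inj₁ (subst C₀ (sym (invol x Ψ)) c)
    ... | inj₁ refl        | inj₂ c = inj₂ (subst C₀ (sym (zx-comm Ψ)) c)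
    ... | inj₂ (inj₁ refl) | inj₁ c = inj₁ (orbit-h⁻¹ c)
    ... | inj₂ (inj₁ refl) | inj₂ c =
      inj₂ (subst C₀ (trans (cong (r y) (invol x _)) (sym (zy-comm Ψ))) (orbit-step c))
    ... | inj₂ (inj₂ refl) | inj₁ c = inj₂ (subst C₀ (sym (invol z Ψ)) c)
    ... | inj₂ (inj₂ refl) | inj₂ c = inj₁ c

    odd⇒even : ∀ j → j ≢ i → ∀ Ψ → Odd Ψ → Even (r j Ψ)
    odd⇒even j j≢i Ψ o with colours j j≢i | o
    ... | inj₁ refl        | inj₁ c = inj₁ c
    ... | inj₁ refl        | inj₂ c =
      inj₂ (subst C₀ (sym (trans (cong (r x) (zx-comm Ψ)) (invol x _))) c)
    ... | inj₂ (inj₁ refl) | inj₁ c = inj₁ (subst C₀ (cong (r y) (invol x Ψ)) (orbit-step c))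
    ... | inj₂ (inj₁ refl) | inj₂ c = inj₂ (subst C₀ (sym (cong (r x) (zy-comm Ψ))) (orbit-h⁻¹ c))
    ... | inj₂ (inj₂ refl) | inj₁ c = inj₂ (subst C₀ (cong (r x) (sym (invol z Ψ))) c)
    ... | inj₂ (inj₂ refl) | inj₂ c = inj₁ c

    face⊆even∪odd : ∀ {Ψ} → InFace M i Φ Ψ → Even Ψ ⊎ Odd Ψ
    face⊆even∪odd here = inj₁ (inj₁ (0 , refl))
    face⊆even∪odd (step j j≢i p) =
      swap (map (even⇒odd j j≢i _) (odd⇒even j j≢i _) (face⊆even∪odd p))

    face-bipartite : FaceBipartite M i Φ
    face-bipartite = (λ Ψ → does (even? Ψ)) , properlyColoured
      where
      properlyColoured : ∀ Ψ → InFace M i Φ Ψ → ∀ j → j ≢ i →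
                         does (even? (r j Ψ)) ≢ does (even? Ψ)
      properlyColoured Ψ p j j≢i with face⊆even∪odd p
      ... | inj₁ e = does-≢ (even? Ψ) (even? (r j Ψ)) e
                       (λ e′ → even⇒¬odd (r j Ψ) e′ (even⇒odd j j≢i Ψ e))
      ... | inj₂ o = ≢-sym (does-≢ (even? (r j Ψ)) (even? Ψ) (odd⇒even j j≢i Ψ o)
                       (λ e → even⇒¬odd Ψ e o))

lemma3 : (M : Maniplex 4) → Connected M → Faithful M →
    (i : Fin 4) → (i ≡ Fin.suc Fin.zero ⊎ i ≡ Fin.suc (Fin.suc Fin.zero)) →
    ∀ Φ → FaceBipartite M i Φ
lemma3 M _ faithful _ (inj₁ refl) =
  Prism.face-bipartite M faithful (# 1) (# 2) (# 3) (# 0) (λ ()) (λ ()) colours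
    (λ Ψ → fourCycle (# 0) (# 2) Ψ (s<s z<s)) (λ Ψ → fourCycle (# 0) (# 3) Ψ (s<s z<s))
  where
  open Maniplex M
  colours : ∀ j → j ≢ # 1 → j ≡ # 2 ⊎ j ≡ # 3 ⊎ j ≡ # 0
  colours Fin.zero                               _   = inj₂ (inj₂ refl)
  colours (Fin.suc Fin.zero)                     j≢1 = contradiction refl j≢1
  colours (Fin.suc (Fin.suc Fin.zero))           _   = inj₁ refl
  colours (Fin.suc (Fin.suc (Fin.suc Fin.zero))) _   = inj₂ (inj₁ refl)
lemma3 M _ faithful _ (inj₂ refl) =
  Prism.face-bipartite M faithful (# 2) (# 0) (# 1) (# 3) (λ ()) (λ ()) colours
    (λ Ψ → fourCycle (# 3) (# 0) Ψ (s<s z<s)) (λ Ψ → fourCycle (# 3) (# 1) Ψ (s<s z<s))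
  where
  open Maniplex M
  colours : ∀ j → j ≢ # 2 → j ≡ # 0 ⊎ j ≡ # 1 ⊎ j ≡ # 3
  colours Fin.zero                               _   = inj₁ refl
  colours (Fin.suc Fin.zero)                     _   = inj₂ (inj₁ refl)
  colours (Fin.suc (Fin.suc Fin.zero))           j≢2 = contradiction refl j≢2
  colours (Fin.suc (Fin.suc (Fin.suc Fin.zero))) _   = inj₂ (inj₂ refl)
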